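{- Let $T=\{123,132,231\}$, $k\geq 1$, and $\tau\in S_k(T)$. Then: (i) there exists $r$ with $1\leq r\leq k$ such that $\tau=(k,k-1,\dots,r+1,\;r-1,r-2,\dots,1,\;r)$; (ii) for every $r$ with $2\leq r\leq k$ and all $n\geq k$, $$|S_n(T,(k,k-1,\dots,r+1,r-1,\dots,1,r))|=k-1.$$
   Context: Permutations are written in one-line notation (a run such as $k,k-1,\dots,r+1$ is empty when $r=k$); $S_k$ is the set of permutations of $\{1,\dots,k\}$. A permutation $\alpha\in S_n$ contains a pattern $\beta$ if some subsequence of $\alpha$ is order-isomorphic to $\beta$; otherwise it avoids $\beta$. $S_n(T,\tau)$ is the set of permutations in $S_n$ avoiding all patterns in $T$ and $\tau$. -}

module Defs where

open import Data.Nat using (ℕ; zero; suc; _∸_; _<_)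
open import Data.List using (List; []; _∷_; _++_; map; upTo; length; lookup; [_])
open import Data.List.Relation.Binary.Sublist.Propositional using (_⊆_)
open import Data.List.Relation.Binary.Permutation.Propositional using (_↭_)
open import Data.List.Relation.Unary.Unique.Propositional using (Unique)
open import Data.List.Membership.Propositional using (_∈_)
open import Data.Fin using (Fin; cast)
open import Data.Product using (Σ; ∃; _×_)
open import Relation.Binary.PropositionalEquality using (_≡_; sym)
open import Relation.Nullary using (¬_)
open import Function.Bundles using (_⇔_)

-- Permutations in one-line notation are lists of naturals.
-- α ∈ S_n  iff  α is a rearrangement of 1,2,…,n.
IsPerm : ℕ → List ℕ → Set
IsPerm n α = α ↭ map suc (upTo n)

OrderIso : List ℕ → List ℕ → Set
OrderIso xs ys =
  Σ (length xs ≡ length ys) λ eq →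
    (i j : Fin (length xs)) →
      (lookup xs i < lookup xs j) ⇔ (lookup ys (cast eq i) < lookup ys (cast eq j))

Contains : List ℕ → List ℕ → Set
Contains α β = ∃ λ xs → xs ⊆ α × OrderIso xs β

Avoids : List ℕ → List ℕ → Set
Avoids α β = ¬ Contains α β

AvoidsAll : List ℕ → List (List ℕ) → Set
AvoidsAll α T = ∀ β → β ∈ T → Avoids α β

T : List (List ℕ)
T = (1 ∷ 2 ∷ 3 ∷ []) ∷ (1 ∷ 3 ∷ 2 ∷ []) ∷ (2 ∷ 3 ∷ 1 ∷ []) ∷ []

-- down a b = a, a-1, …, b+1  (empty when a ≤ b)
down : ℕ → ℕ → List ℕ
down a b = map (λ i → a ∸ i) (upTo (a ∸ b))

pat : ℕ → ℕ → List ℕ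
pat k r = down k r ++ down (r ∸ 1) 0 ++ [ r ]

HasCard : (List ℕ → Set) → ℕ → Set
HasCard P m =
  Σ (List (List ℕ)) λ L → Unique L × (∀ α → (α ∈ L) ⇔ P α) × (length L ≡ m)

InSnTτ : ℕ → List ℕ → List ℕ → Set
InSnTτ n τ α = IsPerm n α × AvoidsAll α T × Avoids α τ

-- Write Pat g t for (g+t+1, …, t+2, t, …, 1, t+1), i.e. pat k r with r = t + 1, k = g + r.
-- In a T-avoider the maximum n is first or last: entries x, z on both sides of it would give
-- 132 (x < z) or 231 (x > z). Deleting a leading maximum leaves a smaller T-avoider; a
-- trailing one forces t = 0, as otherwise 1, t+1, n is a 123. By induction every T-avoider
-- is some Pat g t, and each Pat g t avoids T because all of it but the last entry decreases
-- while every pattern in T starts with an ascent.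
-- For t′ ≥ 1, Pat g t contains Pat g′ t′ iff t′ ≤ t and g′ ≤ g. Hence among the T-avoiders
-- Pat (N − t) t (t ≤ N) of length N + 1, those avoiding Pat g′ t′ are the t < t′ and the
-- t > N − g′: there are t′ + g′ = k − 1 of them.

module Submission where

open import Defs
open import Data.Empty using (⊥-elim)
open import Data.Fin using (zero; suc; cast)
open import Data.List using (List; []; _∷_; _++_; [_]; map; upTo; applyUpTo; length; lookup)
open import Data.List.Properties
  using (++-assoc; ++-identityʳ; map-++; length-++; length-map; length-upTo; length-applyUpTo;
         upTo-∷ʳ; map-upTo; ∷ʳ-injective)
open import Data.List.Membership.Propositional using (_∈_)
open import Data.List.Membership.Propositional.Properties
  using (∈-∃++; ∈-map⁺; ∈-map⁻; ∈-upTo⁺; ∈-upTo⁻; ∈-applyUpTo⁺; ∈-applyUpTo⁻; ∈-++⁺ˡ; ∈-++⁺ʳ; ∈-++⁻)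
open import Data.List.Relation.Unary.All as All using (All; []; _∷_)
import Data.List.Relation.Unary.All.Properties as All
open import Data.List.Relation.Unary.Any using (Any; here; there)
import Data.List.Relation.Unary.Any.Properties as Any
open import Data.List.Relation.Unary.AllPairs using (AllPairs; []; _∷_)
import Data.List.Relation.Unary.AllPairs.Properties as AllPairs
open import Data.List.Relation.Unary.Unique.Propositional using (Unique)
import Data.List.Relation.Unary.Unique.Propositional.Properties as Unique
open import Data.List.Relation.Binary.Sublist.Propositional using (_⊆_; []; _∷_; _∷ʳ_; ⊆-refl; ⊆-trans; minimum)
import Data.List.Relation.Binary.Sublist.Propositional.Properties as Sublist
open import Data.List.Relation.Binary.Permutation.Propositional
  using (_↭_; ↭-refl; ↭-sym; ↭-trans; ↭-reflexive; ↭⇒↭ₛ; module PermutationReasoning)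
import Data.List.Relation.Binary.Permutation.Propositional.Properties as Perm
open import Data.Nat using (ℕ; zero; suc; _+_; _∸_; _≤_; _<_; _>_; z≤n; s≤s; z<s; s<s; _≤?_; _<?_)
open import Data.Nat.Properties
open import Data.Product using (Σ; ∃₂; ∃-syntax; _×_; _,_; proj₁; proj₂)
open import Data.Sum using (_⊎_; inj₁; inj₂)
open import Function using (_$_)
open import Function.Bundles using (_⇔_; mk⇔; module Equivalence)
open import Function.Properties.Equivalence using () renaming (sym to ⇔-sym)
open import Relation.Binary.Definitions using (tri<; tri≈; tri>)
open import Relation.Binary.PropositionalEquality
  using (_≡_; _≢_; refl; sym; trans; cong; cong₂; subst; subst₂; module ≡-Reasoning)
open import Relation.Binary.PropositionalEquality.Properties using (setoid)
open import Relation.Nullary using (¬_; yes; no)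

import Data.List.Relation.Binary.Permutation.Setoid.Properties (setoid ℕ) as PermSetoid
open Equivalence using (to; from)


run : ℕ → ℕ → List ℕ
run zero    b = []
run (suc g) b = suc (g + b) ∷ run g b

Pat : ℕ → ℕ → List ℕ
Pat g t = (run g (suc t) ++ run t 0) ++ [ suc t ]

applyUpTo-∸-run : ∀ {a} g b → a ≡ g + b → applyUpTo (a ∸_) g ≡ run g b
applyUpTo-∸-run zero    b _    = refl
applyUpTo-∸-run (suc g) b refl = cong (suc (g + b) ∷_) (applyUpTo-∸-run g b refl)

down≡run : ∀ {a} g b → a ≡ g + b → down a b ≡ run g b
down≡run {a} g b a≡g+b = begin
  map (a ∸_) (upTo (a ∸ b)) ≡⟨ cong (λ m → map (a ∸_) (upTo m)) a∸b≡g ⟩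
  map (a ∸_) (upTo g)       ≡⟨ map-upTo (a ∸_) g ⟩
  applyUpTo (a ∸_) g        ≡⟨ applyUpTo-∸-run g b a≡g+b ⟩
  run g b                   ∎
  where
  open ≡-Reasoning
  a∸b≡g : a ∸ b ≡ g
  a∸b≡g = trans (cong (_∸ b) a≡g+b) (m+n∸n≡m g b)

pat≡Pat : ∀ g t → pat (g + suc t) (suc t) ≡ Pat g t
pat≡Pat g t = trans
  (cong₂ (λ xs ys → xs ++ ys ++ [ suc t ]) (down≡run g (suc t) refl) (down≡run t 0 (sym (+-identityʳ t))))
  (sym (++-assoc (run g (suc t)) (run t 0) [ suc t ]))

run-++ : ∀ g c b → run (g + c) b ≡ run g (b + c) ++ run c b
run-++ zero    c b = refl
run-++ (suc g) c b = cong₂ _∷_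
  (cong suc (trans (+-assoc g c b) (cong (g +_) (+-comm c b))))
  (run-++ g c b)

map-suc-upTo-∷ʳ : ∀ m → map suc (upTo (suc m)) ≡ map suc (upTo m) ++ [ suc m ]
map-suc-upTo-∷ʳ m = trans (cong (map suc) (sym (upTo-∷ʳ m))) (map-++ suc (upTo m) [ m ])

run-↭ : ∀ m → run m 0 ↭ map suc (upTo m)
run-↭ zero    = ↭-refl
run-↭ (suc m) = begin
  suc (m + 0) ∷ run m 0          ≡⟨ cong (λ v → suc v ∷ run m 0) (+-identityʳ m) ⟩
  suc m ∷ run m 0                ↭⟨ Perm.∷↭∷ʳ (suc m) (run m 0) ⟩
  run m 0 ++ [ suc m ]           ↭⟨ Perm.++⁺ʳ [ suc m ] (run-↭ m) ⟩
  map suc (upTo m) ++ [ suc m ]  ≡⟨ map-suc-upTo-∷ʳ m ⟨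
  map suc (upTo (suc m))         ∎
  where open PermutationReasoning

Pat-isPerm : ∀ g t → IsPerm (g + suc t) (Pat g t)
Pat-isPerm g t = begin
  (run g (suc t) ++ run t 0) ++ [ suc t ]  ≡⟨ ++-assoc (run g (suc t)) (run t 0) [ suc t ] ⟩
  run g (suc t) ++ run t 0 ++ [ suc t ]    ↭⟨ Perm.++⁺ˡ (run g (suc t)) (↭-sym (Perm.∷↭∷ʳ (suc t) (run t 0))) ⟩
  run g (suc t) ++ suc t ∷ run t 0         ≡⟨ cong (λ v → run g (suc t) ++ suc v ∷ run t 0) (+-identityʳ t) ⟨
  run g (suc t) ++ run (suc t) 0           ≡⟨ run-++ g (suc t) 0 ⟨
  run (g + suc t) 0                        ↭⟨ run-↭ (g + suc t) ⟩
  map suc (upTo (g + suc t))               ∎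
  where open PermutationReasoning

length-run : ∀ g b → length (run g b) ≡ g
length-run zero    b = refl
length-run (suc g) b = cong suc (length-run g b)

length-Pat : ∀ g t → length (Pat g t) ≡ g + suc t
length-Pat zero    t = trans (length-++ (run t 0)) (trans (cong (_+ 1) (length-run t 0)) (+-comm t 1))
length-Pat (suc g) t = cong suc (length-Pat g t)

run-< : ∀ g b → All (_< suc (g + b)) (run g b)
run-< zero    b = []
run-< (suc g) b = ≤-refl ∷ All.map m<n⇒m<1+n (run-< g b)

run₀-< : ∀ t → All (_< suc t) (run t 0)
run₀-< t = subst (λ m → All (_< suc m) (run t 0)) (+-identityʳ t) (run-< t 0)

run-> : ∀ g b → All (b <_) (run g b)
run-> zero    b = []
run-> (suc g) b = s≤s (m≤n+m b g) ∷ run-> g b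

Pat-< : ∀ g t → All (_< suc (g + suc t)) (Pat g t)
Pat-< g t = All.++⁺ (All.++⁺ (run-< g (suc t)) (All.map (λ y<1+t → <-trans y<1+t 1+t<) (run₀-< t))) (1+t< ∷ [])
  where
  1+t< : suc t < suc (g + suc t)
  1+t< = s≤s (m≤n+m (suc t) g)

run-⊆ : ∀ {g′ g} b → g′ ≤ g → run g′ b ⊆ run g b
run-⊆ {g = zero}  b z≤n = []
run-⊆ {g = suc g} b g′≤ with m≤n⇒m<n∨m≡n g′≤
... | inj₁ g′<1+g = _ ∷ʳ run-⊆ b (≤-pred g′<1+g)
... | inj₂ refl   = ⊆-refl

[1]⊆run : ∀ u → [ 1 ] ⊆ run (suc u) 0
[1]⊆run zero    = refl ∷ []
[1]⊆run (suc u) = _ ∷ʳ [1]⊆run u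


Descending : List ℕ → Set
Descending = AllPairs _>_

Descending-⊆ : ∀ {xs ys} → xs ⊆ ys → Descending ys → Descending xs
Descending-⊆ []         ds         = ds
Descending-⊆ (y ∷ʳ p)   (_ ∷ ds)   = Descending-⊆ p ds
Descending-⊆ (refl ∷ p) (y> ∷ ds)  = Sublist.All-resp-⊆ p y> ∷ Descending-⊆ p ds

run-descending : ∀ g b → Descending (run g b)
run-descending zero    b = []
run-descending (suc g) b = run-< g b ∷ run-descending g b

Pat-init-descending : ∀ g t → Descending (run g (suc t) ++ run t 0)
Pat-init-descending g t = AllPairs.++⁺ (run-descending g (suc t)) (run-descending t 0)
  (All.map (λ 1+t<x → All.map (λ y<1+t → <-trans y<1+t 1+t<x) (run₀-< t)) (run-> g (suc t)))

⊆-++[]⁻ : ∀ {xs} ys {y : ℕ} → xs ⊆ ys ++ [ y ] → xs ⊆ ys ⊎ ∃[ zs ] xs ≡ zs ++ [ y ] × zs ⊆ ys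
⊆-++[]⁻ []       (_ ∷ʳ p)     = inj₁ p
⊆-++[]⁻ []       (refl ∷ [])  = inj₂ ([] , refl , [])
⊆-++[]⁻ (w ∷ ws) (w ∷ʳ p) with ⊆-++[]⁻ ws p
... | inj₁ q            = inj₁ (w ∷ʳ q)
... | inj₂ (zs , e , q) = inj₂ (zs , e , w ∷ʳ q)
⊆-++[]⁻ (w ∷ ws) (refl ∷ p) with ⊆-++[]⁻ ws p
... | inj₁ q               = inj₁ (refl ∷ q)
... | inj₂ (zs , refl , q) = inj₂ (w ∷ zs , refl , refl ∷ q)

++[]-⊆-++[]⁻ : ∀ xs ys {x y : ℕ} → xs ++ [ x ] ⊆ ys ++ [ y ] → xs ⊆ ys
++[]-⊆-++[]⁻ xs ys p with ⊆-++[]⁻ ys p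
... | inj₁ q            = ⊆-trans (Sublist.++⁺ʳ [ _ ] ⊆-refl) q
... | inj₂ (zs , e , q) = subst (_⊆ ys) (sym (proj₁ (∷ʳ-injective xs zs e))) q

⊆-around : ∀ {x y z : ℕ} xs zs → x ∷ y ∷ z ∷ [] ⊆ x ∷ xs ++ [ y ] ++ z ∷ zs
⊆-around xs zs = refl ∷ Sublist.++⁺ˡ xs (refl ∷ refl ∷ minimum zs)

AvoidsAll-⊆ : ∀ {ys α Π} → ys ⊆ α → AvoidsAll α Π → AvoidsAll ys Π
AvoidsAll-⊆ ys⊆α av β β∈Π (xs , xs⊆ys , iso) = av β β∈Π (xs , ⊆-trans xs⊆ys ys⊆α , iso)


-- Order isomorphisms

OrderIso-tail : ∀ {x y xs ys} → OrderIso (x ∷ xs) (y ∷ ys) → OrderIso xs ys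
OrderIso-tail (eq , iso) = suc-injective eq , λ i j → iso (suc i) (suc j)

OrderIso-drop₂ : ∀ {x x′ y y′ xs ys} → OrderIso (x ∷ x′ ∷ xs) (y ∷ y′ ∷ ys) → OrderIso (x ∷ xs) (y ∷ ys)
OrderIso-drop₂ (eq , iso) = suc-injective eq , λ
  { zero    zero    → iso zero zero
  ; zero    (suc j) → iso zero (suc (suc j))
  ; (suc i) zero    → iso (suc (suc i)) zero
  ; (suc i) (suc j) → iso (suc (suc i)) (suc (suc j)) }

OrderIso-All< : ∀ {x y} xs ys → OrderIso (x ∷ xs) (y ∷ ys) → All (_< y) ys → All (_< x) xs
OrderIso-All< []       []       _   []       = []
OrderIso-All< (_ ∷ xs) (_ ∷ ys) iso (p ∷ ps) =
  from (proj₂ iso (suc zero) zero) p ∷ OrderIso-All< xs ys (OrderIso-drop₂ iso) ps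
OrderIso-All< (_ ∷ _)  []       (() , _) _

OrderIso-Any> : ∀ {x y} xs ys → OrderIso (x ∷ xs) (y ∷ ys) → Any (y <_) ys → Any (x <_) xs
OrderIso-Any> (_ ∷ xs) (_ ∷ ys) iso (here p)  = here (from (proj₂ iso zero (suc zero)) p)
OrderIso-Any> (_ ∷ xs) (_ ∷ ys) iso (there p) = there (OrderIso-Any> xs ys (OrderIso-drop₂ iso) p)
OrderIso-Any> []       (_ ∷ _)  (() , _) _

data HasAscent : List ℕ → Set where
  here  : ∀ {x xs} → Any (x <_) xs → HasAscent (x ∷ xs)
  there : ∀ {x xs} → HasAscent xs → HasAscent (x ∷ xs)

OrderIso-HasAscent : ∀ xs ys → OrderIso xs ys → HasAscent ys → HasAscent xs
OrderIso-HasAscent (_ ∷ xs) (_ ∷ ys) iso (here p)  = here (OrderIso-Any> xs ys iso p)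
OrderIso-HasAscent (_ ∷ xs) (_ ∷ ys) iso (there h) = there (OrderIso-HasAscent xs ys (OrderIso-tail iso) h)
OrderIso-HasAscent []       (_ ∷ _)  (() , _) _

All<⇒¬Any> : ∀ {x xs} → All (_< x) xs → ¬ Any (x <_) xs
All<⇒¬Any> below = All.All¬⇒¬Any (All.map (λ y<x x<y → <-asym x<y y<x) below)

Descending⇒¬HasAscent : ∀ {xs} → Descending xs → ¬ HasAscent xs
Descending⇒¬HasAscent (below ∷ _)  (here p)  = All<⇒¬Any> below p
Descending⇒¬HasAscent (_ ∷ desc)   (there h) = Descending⇒¬HasAscent desc h

SameOrder : ℕ → ℕ → ℕ → ℕ → Set
SameOrder a b p q = (a < b ⇔ p < q) × (b < a ⇔ q < p)

SameOrder-< : ∀ {a b p q} → a < b → p < q → SameOrder a b p q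
SameOrder-< a<b p<q =
  mk⇔ (λ _ → p<q) (λ _ → a<b) , mk⇔ (λ b<a → ⊥-elim (<-asym a<b b<a)) (λ q<p → ⊥-elim (<-asym p<q q<p))

SameOrder-> : ∀ {a b p q} → b < a → q < p → SameOrder a b p q
SameOrder-> b<a q<p =
  mk⇔ (λ a<b → ⊥-elim (<-asym a<b b<a)) (λ p<q → ⊥-elim (<-asym p<q q<p)) , mk⇔ (λ _ → q<p) (λ _ → b<a)

orderIso₃ : ∀ {a b c p q r} → SameOrder a b p q → SameOrder a c p r → SameOrder b c q r →
  OrderIso (a ∷ b ∷ c ∷ []) (p ∷ q ∷ r ∷ [])
orderIso₃ ab ac bc = refl , λ
  { zero             zero             → irrefl⇔
  ; zero             (suc zero)       → proj₁ ab
  ; zero             (suc (suc zero)) → proj₁ ac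
  ; (suc zero)       zero             → proj₂ ab
  ; (suc zero)       (suc zero)       → irrefl⇔
  ; (suc zero)       (suc (suc zero)) → proj₁ bc
  ; (suc (suc zero)) zero             → proj₂ ac
  ; (suc (suc zero)) (suc zero)       → proj₂ bc
  ; (suc (suc zero)) (suc (suc zero)) → irrefl⇔ }
  where
  irrefl⇔ : ∀ {a p} → a < a ⇔ p < p
  irrefl⇔ = mk⇔ (λ a<a → ⊥-elim (<-irrefl refl a<a)) (λ p<p → ⊥-elim (<-irrefl refl p<p))

orderIso₃-ascent : ∀ {xs p q r} → OrderIso xs (p ∷ q ∷ r ∷ []) → p < q →
  ∃[ a ] ∃[ b ] ∃[ c ] xs ≡ a ∷ b ∷ c ∷ [] × a < b
orderIso₃-ascent {a ∷ b ∷ c ∷ []} (_ , iso) p<q = a , b , c , refl , from (iso zero (suc zero)) p<q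
orderIso₃-ascent {[]}                   (() , _)
orderIso₃-ascent {_ ∷ []}               (() , _)
orderIso₃-ascent {_ ∷ _ ∷ []}           (() , _)
orderIso₃-ascent {_ ∷ _ ∷ _ ∷ _ ∷ _}    (() , _)

lookup-map : ∀ (f : ℕ → ℕ) ys i → lookup (map f ys) i ≡ f (lookup ys (cast (length-map f ys) i))
lookup-map f (y ∷ ys) zero    = refl
lookup-map f (y ∷ ys) (suc i) = lookup-map f ys i

StrictlyIncreasing : (ℕ → ℕ) → Set
StrictlyIncreasing f = ∀ {a b} → a < b → f a < f b

StrictlyIncreasing⇒⇔ : ∀ {f} → StrictlyIncreasing f → ∀ a b → a < b ⇔ f a < f b
StrictlyIncreasing⇒⇔ inc a b = mk⇔ inc reflect
  where
  reflect : _ → a < b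
  reflect fa<fb with <-cmp a b
  ... | tri< a<b _ _ = a<b
  ... | tri≈ _ refl _ = ⊥-elim (<-irrefl refl fa<fb)
  ... | tri> _ _ b<a = ⊥-elim (<-asym fa<fb (inc b<a))

map-OrderIso : ∀ {f} → StrictlyIncreasing f → ∀ ys → OrderIso (map f ys) ys
map-OrderIso {f} inc ys = length-map f ys , λ i j →
  subst₂ (λ u v → u < v ⇔ lookup ys (cast (length-map f ys) i) < lookup ys (cast (length-map f ys) j))
    (sym (lookup-map f ys i)) (sym (lookup-map f ys j))
    (⇔-sym (StrictlyIncreasing⇒⇔ inc _ _))


descending-++[]-avoids : ∀ {D p q r} s → Descending D → p < q → Avoids (D ++ [ s ]) (p ∷ q ∷ r ∷ [])
descending-++[]-avoids {D} s desc p<q (xs , xs⊆ , iso) with orderIso₃-ascent {xs} iso p<q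
... | a , b , c , refl , a<b with Descending-⊆ (++[]-⊆-++[]⁻ (a ∷ b ∷ []) D xs⊆) desc
... | (b<a ∷ _) ∷ _ = <-asym a<b b<a

1<2 : 1 < 2
1<2 = s<s z<s

1<3 : 1 < 3
1<3 = s<s z<s

2<3 : 2 < 3
2<3 = s<s (s<s z<s)

Pat-avoids-T : ∀ g t → AvoidsAll (Pat g t) T
Pat-avoids-T g t _ (here refl)                 = descending-++[]-avoids _ (Pat-init-descending g t) 1<2
Pat-avoids-T g t _ (there (here refl))         = descending-++[]-avoids _ (Pat-init-descending g t) 1<3
Pat-avoids-T g t _ (there (there (here refl))) = descending-++[]-avoids _ (Pat-init-descending g t) 2<3


-- Containment among the Pat g t

Pat₀-head-ascent : ∀ u → Any (suc (u + 0) <_) (run u 0 ++ [ suc (suc u) ])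
Pat₀-head-ascent u = Any.++⁺ʳ (run u 0) (here (s≤s (s≤s (≤-reflexive (+-identityʳ u)))))

Pat-ascent : ∀ g u → HasAscent (Pat g (suc u))
Pat-ascent zero    u = here (Pat₀-head-ascent u)
Pat-ascent (suc g) u = there (Pat-ascent g u)

no-peak-before-ascent : ∀ t {x xs} → x ∷ xs ⊆ run t 0 ++ [ suc t ] → All (_< x) xs → ¬ HasAscent xs
no-peak-before-ascent t sub below asc with ⊆-++[]⁻ (run t 0) sub
... | inj₁ sub′ = Descending⇒¬HasAscent (Descending-⊆ (Sublist.∷ˡ⁻ sub′) (run-descending t 0)) asc
... | inj₂ ([] , refl , _) with asc
...   | ()
no-peak-before-ascent t {x} sub below asc | inj₂ (_ ∷ zs , refl , sub′) =
  <-asym (All.lookup below (Any.++⁺ʳ zs (here refl))) (All.head (Sublist.All-resp-⊆ sub′ (run₀-< t)))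

-- Common leading maxima can be stripped, since Pat (suc g) t = _ ∷ Pat g t. When g′ = 0 the
-- head of the pattern is exceeded later on, impossible if it sits at the maximum of Pat (suc g) t;
-- when g = 0 the occurrence lies in t, …, 1, t+1, which has no peak followed by an ascent.
Pat-embedding : ∀ g′ u g t {xs} → xs ⊆ Pat g t → OrderIso xs (Pat g′ (suc u)) → suc u ≤ t × g′ ≤ g
Pat-embedding zero     u _       t {[]} _ (() , _)
Pat-embedding (suc g′) u _       t {[]} _ (() , _)
Pat-embedding zero     u zero    t xs⊆ iso =
  ≤-pred (subst₂ _≤_ (trans (proj₁ iso) (length-Pat 0 (suc u))) (length-Pat 0 t) (Sublist.length-mono-≤ xs⊆)) , z≤n
Pat-embedding zero     u (suc g) t (_ ∷ʳ xs⊆) iso = proj₁ (Pat-embedding zero u g t xs⊆ iso) , z≤n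
Pat-embedding zero     u (suc g) t {_ ∷ xs} (refl ∷ xs⊆) iso =
  ⊥-elim (All<⇒¬Any> (Sublist.All-resp-⊆ xs⊆ (Pat-< g t)) (OrderIso-Any> xs _ iso (Pat₀-head-ascent u)))
Pat-embedding (suc g′) u zero    t {_ ∷ xs} xs⊆ iso = ⊥-elim (no-peak-before-ascent t xs⊆
  (OrderIso-All< xs _ iso (Pat-< g′ (suc u))) (OrderIso-HasAscent xs _ (OrderIso-tail iso) (Pat-ascent g′ u)))
Pat-embedding (suc g′) u (suc g) t {_ ∷ _} xs⊆ iso
  with Pat-embedding g′ u g t (Sublist.∷⁻ xs⊆) (OrderIso-tail iso)
... | t≥ , g≥ = t≥ , s≤s g≥

lift : ℕ → ℕ → ℕ → ℕ
lift c d v with v ≤? c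
... | yes _ = v
... | no  _ = v + d

lift-≤ : ∀ {c} d {v} → v ≤ c → lift c d v ≡ v
lift-≤ {c} d {v} v≤c with v ≤? c
... | yes _   = refl
... | no  v≰c = ⊥-elim (v≰c v≤c)

lift-> : ∀ {c} d {v} → c < v → lift c d v ≡ v + d
lift-> {c} d {v} c<v with v ≤? c
... | yes v≤c = ⊥-elim (<-irrefl refl (<-≤-trans c<v v≤c))
... | no  _   = refl

lift-increasing : ∀ c d → StrictlyIncreasing (lift c d)
lift-increasing c d {a} {b} a<b with a ≤? c | b ≤? c
... | yes _   | yes _   = a<b
... | yes _   | no  _   = <-≤-trans a<b (m≤m+n b d)
... | no  a≰c | yes b≤c = ⊥-elim (<-asym a<b (≤-<-trans b≤c (≰⇒> a≰c)))
... | no  _   | no  _   = +-monoˡ-< d a<b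

map-lift-run-above : ∀ {c} d g b → c ≤ b → map (lift c d) (run g b) ≡ run g (b + d)
map-lift-run-above d zero    b c≤b = refl
map-lift-run-above d (suc g) b c≤b = cong₂ _∷_
  (trans (lift-> d (s≤s (≤-trans c≤b (m≤n+m b g)))) (cong suc (+-assoc g b d)))
  (map-lift-run-above d g b c≤b)

map-lift-run-below : ∀ {c} d g b → g + b ≤ c → map (lift c d) (run g b) ≡ run g b
map-lift-run-below d zero    b _   = refl
map-lift-run-below d (suc g) b g+b<c = cong₂ _∷_
  (lift-≤ d g+b<c) (map-lift-run-below d g b (<⇒≤ g+b<c))

map-lift-Pat : ∀ d g t → map (lift t d) (Pat g t) ≡ (run g (suc t + d) ++ run t 0) ++ [ suc t + d ]
map-lift-Pat d g t = begin
  map (lift t d) ((run g (suc t) ++ run t 0) ++ [ suc t ])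
    ≡⟨ map-++ (lift t d) (run g (suc t) ++ run t 0) [ suc t ] ⟩
  map (lift t d) (run g (suc t) ++ run t 0) ++ [ lift t d (suc t) ]
    ≡⟨ cong₂ _++_ (map-++ (lift t d) (run g (suc t)) (run t 0)) (cong [_] (lift-> d ≤-refl)) ⟩
  (map (lift t d) (run g (suc t)) ++ map (lift t d) (run t 0)) ++ [ suc t + d ]
    ≡⟨ cong (λ xs → xs ++ [ suc t + d ])
            (cong₂ _++_ (map-lift-run-above d g (suc t) (n≤1+n t))
                        (map-lift-run-below d t 0 (≤-reflexive (+-identityʳ t)))) ⟩
  (run g (suc t + d) ++ run t 0) ++ [ suc t + d ] ∎
  where open ≡-Reasoning

-- lift t′ (t ∸ t′) maps Pat g′ t′ onto a subsequence of Pat g t.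
Pat-contains : ∀ {g′ g t′ t} → t′ ≤ t → g′ ≤ g → Contains (Pat g t) (Pat g′ t′)
Pat-contains {g′} {g} {t′} {t} t′≤t g′≤g =
  map (lift t′ (t ∸ t′)) (Pat g′ t′) , lifted⊆ , map-OrderIso (lift-increasing t′ (t ∸ t′)) (Pat g′ t′)
  where
  lifted⊆ : map (lift t′ (t ∸ t′)) (Pat g′ t′) ⊆ Pat g t
  lifted⊆ rewrite map-lift-Pat (t ∸ t′) g′ t′ | m+[n∸m]≡n t′≤t =
    Sublist.++⁺ (Sublist.++⁺ (run-⊆ (suc t) g′≤g) (run-⊆ 0 t′≤t)) ⊆-refl


-- Classification of the T-avoiders

Canonical : ℕ → List ℕ → Set
Canonical n α = ∃₂ λ g t → n ≡ g + suc t × α ≡ Pat g t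

Canonical-∷ : ∀ {n α} → Canonical n α → Canonical (suc n) (suc n ∷ α)
Canonical-∷ (g , t , refl , refl) = suc g , t , refl , refl

Pat[g,0]≡run : ∀ g → Pat g 0 ≡ run (g + 1) 0
Pat[g,0]≡run g = trans (cong (_++ [ 1 ]) (++-identityʳ (run g 1))) (sym (run-++ g 1 0))

Pat-++-contains-123 : ∀ g u {M} → suc (suc u) < M → Contains (Pat g (suc u) ++ [ M ]) (1 ∷ 2 ∷ 3 ∷ [])
Pat-++-contains-123 g u b<M =
  _ , occurrence , orderIso₃ (SameOrder-< 1<b 1<2) (SameOrder-< (<-trans 1<b b<M) 1<3) (SameOrder-< b<M 2<3)
  where
  1<b : 1 < suc (suc u)
  1<b = s<s z<s
  occurrence : 1 ∷ suc (suc u) ∷ _ ∷ [] ⊆ Pat g (suc u) ++ [ _ ]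
  occurrence = Sublist.++⁺ (Sublist.++⁺ (Sublist.++⁺ˡ (run g (suc (suc u))) ([1]⊆run u)) ⊆-refl) ⊆-refl

Canonical-++[max] : ∀ {n α} → Canonical n α → AvoidsAll (α ++ [ suc n ]) T → Canonical (suc n) (α ++ [ suc n ])
Canonical-++[max] (g , zero , refl , refl) _ = 0 , g + 1 , refl , cong (_++ [ suc (g + 1) ]) (Pat[g,0]≡run g)
Canonical-++[max] (g , suc u , refl , refl) av =
  ⊥-elim (av _ (here refl) (Pat-++-contains-123 g u (s≤s (m≤n+m (suc (suc u)) g))))

max-between-contains-T : ∀ {x z M} xs zs → x ≢ z → x < M → z < M → ¬ AvoidsAll (x ∷ xs ++ [ M ] ++ z ∷ zs) T
max-between-contains-T {x} {z} xs zs x≢z x<M z<M av with <-cmp x z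
... | tri< x<z _ _ = av _ (there (here refl)) (_ , ⊆-around xs zs , orderIso₃
  (SameOrder-< x<M 1<3) (SameOrder-< x<z 1<2) (SameOrder-> z<M 2<3))
... | tri≈ _ x≡z _ = x≢z x≡z
... | tri> _ _ z<x = av _ (there (there (here refl))) (_ , ⊆-around xs zs , orderIso₃
  (SameOrder-< x<M 2<3) (SameOrder-> z<x 1<2) (SameOrder-> z<M 1<3))

∈-map-suc-upTo⁻ : ∀ {m v} → v ∈ map suc (upTo m) → v < suc m
∈-map-suc-upTo⁻ v∈ with ∈-map⁻ suc v∈
... | i , i∈ , refl = s≤s (∈-upTo⁻ i∈)

map-suc-upTo-unique : ∀ m → Unique (map suc (upTo m))
map-suc-upTo-unique m = Unique.map⁺ suc-injective (Unique.upTo⁺ m)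

↭-drop-max : ∀ m xs zs → xs ++ [ suc m ] ++ zs ↭ map suc (upTo (suc m)) → xs ++ zs ↭ map suc (upTo m)
↭-drop-max m xs zs p = ↭-trans
  (Perm.drop-mid xs (map suc (upTo m)) (↭-trans p (↭-reflexive (map-suc-upTo-∷ʳ m))))
  (↭-reflexive (++-identityʳ (map suc (upTo m))))

classify : ∀ {n} α → 1 ≤ n → IsPerm n α → AvoidsAll α T → Canonical n α
classify-around-max : ∀ m xs zs → xs ++ zs ↭ map suc (upTo m) → AvoidsAll (xs ++ [ suc m ] ++ zs) T →
  Canonical (suc m) (xs ++ [ suc m ] ++ zs)

classify {suc m} α _ perm av with ∈-∃++ (Perm.∈-resp-↭ (↭-sym perm) (∈-map⁺ suc (∈-upTo⁺ (n<1+n m))))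
... | xs , zs , refl = classify-around-max m xs zs (↭-drop-max m xs zs perm) av

classify-around-max zero [] zs p _ with Perm.↭-empty-inv p
... | refl = 0 , 0 , refl , refl
classify-around-max (suc m) [] zs p av = Canonical-∷ (classify zs (s≤s z≤n) p (AvoidsAll-⊆ (_ ∷ʳ ⊆-refl) av))
classify-around-max zero (x ∷ xs) zs p _ with Perm.↭-empty-inv p
... | ()
classify-around-max (suc m) (x ∷ xs) [] p av = Canonical-++[max] (classify (x ∷ xs) (s≤s z≤n) p′ av′) av
  where
  p′ = subst (_↭ map suc (upTo (suc m))) (++-identityʳ (x ∷ xs)) p
  av′ = AvoidsAll-⊆ (Sublist.++⁺ʳ _ ⊆-refl) av
classify-around-max m (x ∷ xs) (z ∷ zs) p av = ⊥-elim $
  max-between-contains-T xs zs x≢z (∈-map-suc-upTo⁻ (Perm.∈-resp-↭ p (here refl)))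
    (∈-map-suc-upTo⁻ (Perm.∈-resp-↭ p (∈-++⁺ʳ (x ∷ xs) (here refl)))) av
  where
  x≢z : x ≢ z
  x≢z with PermSetoid.Unique-resp-↭ (↭⇒↭ₛ (↭-sym p)) (map-suc-upTo-unique m)
  ... | x≢ ∷ _ = All.lookup x≢ (∈-++⁺ʳ xs (here refl))

pat-shape : (k : ℕ) → 1 ≤ k → (τ : List ℕ) → IsPerm k τ → AvoidsAll τ T →
  Σ ℕ λ r → (1 ≤ r) × (r ≤ k) × (τ ≡ pat k r)
pat-shape k 1≤k τ perm av with classify τ 1≤k perm av
... | g , t , refl , refl = suc t , s≤s z≤n , m≤n+m (suc t) g , sym (pat≡Pat g t)

T-avoider⇒Pat : ∀ {N α} → IsPerm (suc N) α → AvoidsAll α T → ∃[ t ] t ≤ N × α ≡ Pat (N ∸ t) t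
T-avoider⇒Pat {N} {α} perm av with classify α (s≤s z≤n) perm av
... | g , t , 1+N≡ , refl = t , subst (t ≤_) g+t≡N (m≤n+m t g) , cong (λ h → Pat h t) (sym N∸t≡g)
  where
  g+t≡N : g + t ≡ N
  g+t≡N = suc-injective (trans (sym (+-suc g t)) (sym 1+N≡))
  N∸t≡g : N ∸ t ≡ g
  N∸t≡g = trans (cong (_∸ t) (sym g+t≡N)) (m+n∸n≡m g t)

Pat-isPerm-∸ : ∀ {N t} → t ≤ N → IsPerm (suc N) (Pat (N ∸ t) t)
Pat-isPerm-∸ {N} {t} t≤N =
  subst (λ n → IsPerm n (Pat (N ∸ t) t)) (trans (+-suc (N ∸ t) t) (cong suc (m∸n+n≡m t≤N))) (Pat-isPerm (N ∸ t) t)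


-- Counting

module PatAvoiders (g′ u w : ℕ) (u<w : u < w) where

  N : ℕ
  N = g′ + w

  F : ℕ → List ℕ
  F t = Pat (N ∸ t) t

  indices : List ℕ
  indices = upTo (suc u) ++ applyUpTo (suc w +_) g′

  g′≤N∸t⇔t≤w : ∀ {t} → t ≤ N → g′ ≤ N ∸ t ⇔ t ≤ w
  g′≤N∸t⇔t≤w t≤N = mk⇔
    (λ g′≤ → +-cancelˡ-≤ g′ _ w (m≤o∸n⇒m+n≤o g′ t≤N g′≤))
    (λ t≤w → m+n≤o⇒m≤o∸n g′ (+-monoʳ-≤ g′ t≤w))

  F-avoids⇔ : ∀ {t} → t ≤ N → Avoids (F t) (Pat g′ (suc u)) ⇔ (t < suc u ⊎ w < t)
  F-avoids⇔ {t} t≤N = mk⇔ index-condition avoids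
    where
    avoids : t < suc u ⊎ w < t → Avoids (F t) (Pat g′ (suc u))
    avoids cond (xs , xs⊆ , iso) with Pat-embedding g′ u (N ∸ t) t xs⊆ iso | cond
    ... | 1+u≤t , _   | inj₁ t<1+u = <-irrefl refl (<-≤-trans t<1+u 1+u≤t)
    ... | _    , g′≤ | inj₂ w<t  = <-irrefl refl (<-≤-trans w<t (to (g′≤N∸t⇔t≤w t≤N) g′≤))
    index-condition : Avoids (F t) (Pat g′ (suc u)) → t < suc u ⊎ w < t
    index-condition av with t <? suc u | w <? t
    ... | yes t<1+u | _       = inj₁ t<1+u
    ... | no  _    | yes w<t = inj₂ w<t
    ... | no  t≮1+u | no  w≮t =
      ⊥-elim (av (Pat-contains (≮⇒≥ t≮1+u) (from (g′≤N∸t⇔t≤w t≤N) (≮⇒≥ w≮t))))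

  ∈-indices⁻ : ∀ {t} → t ∈ indices → t ≤ N × (t < suc u ⊎ w < t)
  ∈-indices⁻ t∈ with ∈-++⁻ (upTo (suc u)) t∈
  ... | inj₁ t∈₁ = ≤-trans (<⇒≤ (<-≤-trans t<1+u u<w)) (m≤n+m w g′) , inj₁ t<1+u
    where t<1+u = ∈-upTo⁻ t∈₁
  ... | inj₂ t∈₂ with ∈-applyUpTo⁻ (suc w +_) t∈₂
  ...   | i , i<g′ , refl = subst (suc w + i ≤_) (+-comm w g′) (+-monoʳ-< w i<g′) , inj₂ (s≤s (m≤m+n w i))

  ∈-indices⁺ : ∀ {t} → t ≤ N → t < suc u ⊎ w < t → t ∈ indices
  ∈-indices⁺ _   (inj₁ t<1+u) = ∈-++⁺ˡ (∈-upTo⁺ t<1+u)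
  ∈-indices⁺ {t} t≤N (inj₂ w<t) = ∈-++⁺ʳ (upTo (suc u))
    (subst (_∈ applyUpTo (suc w +_) g′) (m+[n∸m]≡n w<t) (∈-applyUpTo⁺ (suc w +_) i<g′))
    where
    i<g′ : t ∸ suc w < g′
    i<g′ = +-cancelˡ-< (suc w) _ g′
      (subst (_< suc w + g′) (sym (m+[n∸m]≡n w<t)) (s≤s (subst (t ≤_) (+-comm g′ w) t≤N)))

  indices-unique : Unique indices
  indices-unique = Unique.++⁺ (Unique.upTo⁺ (suc u))
    (Unique.applyUpTo⁺₁ (suc w +_) g′ (λ i<j _ → <⇒≢ (+-monoʳ-< (suc w) i<j)))
    (λ (t∈₁ , t∈₂) → <-asym (<-≤-trans (∈-upTo⁻ t∈₁) u<w) (w<t t∈₂))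
    where
    w<t : ∀ {t} → t ∈ applyUpTo (suc w +_) g′ → w < t
    w<t t∈ with ∈-applyUpTo⁻ (suc w +_) t∈
    ... | i , _ , refl = s≤s (m≤m+n w i)

  F-injective : ∀ {a b} → F a ≡ F b → a ≡ b
  F-injective {a} {b} eq = suc-injective (proj₂ (∷ʳ-injective (run (N ∸ a) (suc a) ++ run a 0) _ eq))

  length-indices : length (map F indices) ≡ g′ + suc u
  length-indices = begin
    length (map F indices)                                     ≡⟨ length-map F indices ⟩
    length (upTo (suc u) ++ applyUpTo (suc w +_) g′)           ≡⟨ length-++ (upTo (suc u)) ⟩
    length (upTo (suc u)) + length (applyUpTo (suc w +_) g′)
      ≡⟨ cong₂ _+_ (length-upTo (suc u)) (length-applyUpTo _ g′) ⟩
    suc u + g′                                                 ≡⟨ +-comm (suc u) g′ ⟩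
    g′ + suc u                                                 ∎
    where open ≡-Reasoning

  count : HasCard (InSnTτ (suc N) (Pat g′ (suc u))) (g′ + suc u)
  count = map F indices , Unique.map⁺ F-injective indices-unique , (λ α → mk⇔ sound complete) , length-indices
    where
    sound : ∀ {α} → α ∈ map F indices → InSnTτ (suc N) (Pat g′ (suc u)) α
    sound α∈ with ∈-map⁻ F α∈
    ... | t , t∈ , refl with ∈-indices⁻ t∈
    ...   | t≤N , cond = Pat-isPerm-∸ t≤N , Pat-avoids-T (N ∸ t) t , from (F-avoids⇔ t≤N) cond
    complete : ∀ {α} → InSnTτ (suc N) (Pat g′ (suc u)) α → α ∈ map F indices
    complete (perm , av , avP) with T-avoider⇒Pat perm av
    ... | t , t≤N , refl = ∈-map⁺ F (∈-indices⁺ t≤N (to (F-avoids⇔ t≤N) avP))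

count-pat-avoiders : (k r : ℕ) → 2 ≤ r → r ≤ k → (n : ℕ) → k ≤ n → HasCard (InSnTτ n (pat k r)) (k ∸ 1)
count-pat-avoiders .zero (suc (suc u)) _ () zero z≤n
count-pat-avoiders k (suc (suc u)) (s≤s (s≤s z≤n)) r≤k (suc N) k≤n =
  subst₂ (λ k N → HasCard (InSnTτ (suc N) (pat k (suc (suc u)))) (k ∸ 1)) k≡ N≡ counted
  where
  g′ = k ∸ suc (suc u)
  k≡ : g′ + suc (suc u) ≡ k
  k≡ = m∸n+n≡m r≤k
  g′+1+u≤N : g′ + suc u ≤ N
  g′+1+u≤N = ≤-pred (subst (_≤ suc N) (trans (sym k≡) (+-suc g′ (suc u))) k≤n)
  w = N ∸ g′
  N≡ : g′ + w ≡ N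
  N≡ = m+[n∸m]≡n (≤-trans (m≤m+n g′ (suc u)) g′+1+u≤N)
  u<w : u < w
  u<w = +-cancelˡ-≤ g′ (suc u) w (subst (g′ + suc u ≤_) (sym N≡) g′+1+u≤N)
  counted : HasCard (InSnTτ (suc (g′ + w)) (pat (g′ + suc (suc u)) (suc (suc u)))) (g′ + suc (suc u) ∸ 1)
  counted rewrite pat≡Pat g′ (suc u) | +-suc g′ (suc u) = PatAvoiders.count g′ u w u<w

theorem6 : ((k : ℕ) → 1 ≤ k → (τ : List ℕ) → IsPerm k τ → AvoidsAll τ T →
    Σ ℕ λ r → (1 ≤ r) × (r ≤ k) × (τ ≡ pat k r))
  × ((k r : ℕ) → 2 ≤ r → r ≤ k → (n : ℕ) → k ≤ n → HasCard (InSnTτ n (pat k r)) (k ∸ 1))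
theorem6 = pat-shape , count-pat-avoiders
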